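{- Let $m$ be a positive multiple of $3$, and for $z\in\{0,1\}$ let $\mathcal G_z$ be the uniform distribution over $\{x\in\{0,1\}^m: \textsc{GapMaj}(x)=z\}$. For every conjunction $C\colon\{0,1\}^m\to\{0,1\}$ of width $w\le m/7$ and each $z\in\{0,1\}$, \[C(\mathcal G_z)\le 3^w\cdot C(\mathcal G_{1-z}).\]
   Context: $\textsc{GapMaj}(x)=0$ if $|x|=m/3$ and $=1$ if $|x|=2m/3$ (Hamming weight), undefined otherwise. A conjunction is an AND of literals (variables or negated variables); its width is its number of literals. For a distribution $\mathcal D$, $C(\mathcal D)=\Pr_{x\sim\mathcal D}[C(x)=1]$. -}

module Defs where

open import Data.Nat using (ℕ; zero; suc; _+_; _*_)
open import Data.Bool using (Bool; true; false; _∧_; if_then_else_)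
open import Data.Fin using (Fin)
open import Data.Vec using (Vec; []; _∷_; lookup; count)
open import Data.List using (List; []; _∷_; length; filter)
open import Data.Product using (_×_; _,_)
open import Data.Bool.Properties using (_≟_)
open import Relation.Nullary.Decidable using (⌊_⌋)
open import Relation.Binary.PropositionalEquality using (_≡_)
open import Data.Nat.Properties using () renaming (_≟_ to _≟ℕ_)

-- All points of {0,1}^m, as a list (true = 1).
cube : (m : ℕ) → List (Vec Bool m)
cube zero = [] ∷ []
cube (suc m) = Data.List.map (false ∷_) (cube m) Data.List.++ Data.List.map (true ∷_) (cube m)

weight : ∀ {m} → Vec Bool m → ℕ
weight [] = 0
weight (true ∷ x) = suc (weight x)
weight (false ∷ x) = weight x

-- A literal: variable index and polarity (true = x_i, false = ¬x_i).
Literal : ℕ → Set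
Literal m = Fin m × Bool

Conjunction : ℕ → Set
Conjunction m = List (Literal m)

width : ∀ {m} → Conjunction m → ℕ
width = length

evalLit : ∀ {m} → Literal m → Vec Bool m → Bool
evalLit (i , true) x = lookup x i
evalLit (i , false) x = Data.Bool.not (lookup x i)

evalC : ∀ {m} → Conjunction m → Vec Bool m → Bool
evalC [] x = true
evalC (l ∷ C) x = evalLit l x ∧ evalC C x

-- With m = 3k: GapMaj(x) = 0 iff |x| = k, GapMaj(x) = 1 iff |x| = 2k.
-- Hamming weight of the support of 𝒢_z.
gapWeight : ℕ → Bool → ℕ
gapWeight k false = k
gapWeight k true = k + k

support : (k : ℕ) → Bool → List (Vec Bool (3 * k))
support k z = filter (λ x → weight x ≟ℕ gapWeight k z) (cube (3 * k))

hits : (k : ℕ) → Conjunction (3 * k) → Bool → ℕ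
hits k C z = length (filter (λ x → evalC C x ≟ true) (support k z))

-- |supp 𝒢_z|, so that C(𝒢_z) = hits k C z / total k z.
total : (k : ℕ) → Bool → ℕ
total k z = length (support k z)

-- A satisfiable conjunction with p positive and n negative literals fixes p + n
-- variables and leaves f free, so it accepts exactly C(f, t − p) points of weight t.
-- With m = 3K, x = K − p and y = K − n (so f = x + K + y) the two hit counts are
-- C(f, x) and C(f, K + x) = C(f, y), while both supports have size C(3K, K).
-- At x = y = K the counts agree; lowering x by one (a positive literal) multiplies
-- their ratio by (x + 1)/(K + x + 1) ≤ 1, and lowering y by one (a negative literal)
-- multiplies it by (K + y + 1)/(y + 1), which is at most 3 because 7w ≤ 3K forces 2n ≤ K.

module Submission where

open import Defs
open import Data.Nat using (ℕ; zero; suc; _+_; _*_; _^_; _∸_; _!; _≤_; _<_; s≤s; z≤n)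
open import Data.Nat.Properties
  using ( +-suc; +-comm; *-comm; +-identityʳ; *-identityˡ; *-assoc; m+n∸m≡n; m∸n+n≡m
        ; suc-injective; +-cancelˡ-≡; *-cancelʳ-≡; *-cancelʳ-≤; *-cancelˡ-≤
        ; ≤-reflexive; ≤-trans; n≤1+n; m≤m+n; m≤n+m; m≤n*m; +-monoˡ-≤; +-monoʳ-≤; *-monoˡ-≤; *-monoʳ-≤; +-cancelʳ-≤
        ; ^-monoʳ-≤; _!≢0; _!*_!≢0; module ≤-Reasoning )
  renaming (_≟_ to _≟ℕ_)
open import Data.Nat.Combinatorics using (nCk≡n!/k![n-k]!; k![n∸k]!∣n!; nCk+nC[k+1]≡[n+1]C[k+1])
  renaming (_C_ to _choose_)
open import Data.Nat.DivMod using (m/n*n≡m)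
open import Data.Nat.Solver using (module +-*-Solver)
open import Data.Bool using (Bool; true; false; _∧_; not; if_then_else_)
open import Data.Bool.Properties using (_≟_; ∧-assoc; ∧-commutativeMonoid)
open import Algebra.Bundles using (CommutativeMonoid)
open import Algebra.Properties.CommutativeSemigroup (CommutativeMonoid.commutativeSemigroup ∧-commutativeMonoid)
  using (x∙yz≈y∙xz)
open import Data.Fin using (zero; suc)
open import Data.Vec using (Vec; []; _∷_)
open import Data.List using (List; []; _∷_; _++_; length; filter; map)
open import Data.List.Properties using (length-++; length-map; filter-++; filter-all; filter-none; filter-≐)
open import Data.List.Relation.Unary.All as All using ()
open import Data.Product using (_×_; _,_; proj₁; proj₂)
open import Data.Sum using (_⊎_; inj₁; inj₂)
open import Function using (_∘_)
open import Relation.Unary using (Pred; Decidable)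
open import Relation.Nullary.Decidable using (does)
open import Relation.Binary.PropositionalEquality

open +-*-Solver

nCk*k![n∸k]!≡n! : ∀ {n k} → k ≤ n → (n choose k) * (k ! * (n ∸ k) !) ≡ n !
nCk*k![n∸k]!≡n! {n} {k} k≤n = trans (cong (_* (k ! * (n ∸ k) !)) (nCk≡n!/k![n-k]! k≤n))
  (m/n*n≡m {{k !* (n ∸ k) !≢0}} (k![n∸k]!∣n! k≤n))

shift : (ℕ → ℕ) → ℕ → ℕ
shift N zero = 0
shift N (suc t) = N t

shift-cong : ∀ {M N : ℕ → ℕ} → (∀ t → M t ≡ N t) → ∀ t → shift M t ≡ shift N t
shift-cong M≗N zero = refl
shift-cong M≗N (suc t) = M≗N t

shift-zero : ∀ {M : ℕ → ℕ} → (∀ t → M t ≡ 0) → ∀ t → shift M t ≡ 0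
shift-zero M≡0 zero = refl
shift-zero M≡0 (suc t) = M≡0 t

choose-pascal : ∀ n t → (n choose t) + shift (n choose_) t ≡ (suc n choose t)
choose-pascal n zero = refl
choose-pascal n (suc k) = trans (+-comm (n choose suc k) (n choose k)) (nCk+nC[k+1]≡[n+1]C[k+1] n k)

shiftBy : ℕ → (ℕ → ℕ) → ℕ → ℕ
shiftBy zero N = N
shiftBy (suc p) N = shift (shiftBy p N)

shiftBy-+ : ∀ p N s → shiftBy p N (p + s) ≡ N s
shiftBy-+ zero N s = refl
shiftBy-+ (suc p) N s = shiftBy-+ p N s

shiftBy-pascal : ∀ p n t → shiftBy p (n choose_) t + shift (shiftBy p (n choose_)) t ≡ shiftBy p (suc n choose_) t
shiftBy-pascal zero n t = choose-pascal n t
shiftBy-pascal (suc p) n zero = refl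
shiftBy-pascal (suc p) n (suc t) = shiftBy-pascal p n t

paths : ℕ → ℕ → ℕ
paths u v = (u + v) choose u

paths-! : ∀ u v → paths u v * (u ! * v !) ≡ (u + v) !
paths-! u v = subst (λ r → paths u v * (u ! * r !) ≡ (u + v) !) (m+n∸m≡n u v) (nCk*k![n∸k]!≡n! (m≤m+n u v))

paths-comm : ∀ u v → paths u v ≡ paths v u
paths-comm u v = *-cancelʳ-≡ _ _ (u ! * v !) {{u !* v !≢0}} (begin
  paths u v * (u ! * v !)  ≡⟨ paths-! u v ⟩
  (u + v) !                ≡⟨ cong _! (+-comm u v) ⟩
  (v + u) !                ≡⟨ paths-! v u ⟨
  paths v u * (v ! * u !)  ≡⟨ cong (paths v u *_) (*-comm (v !) (u !)) ⟩
  paths v u * (u ! * v !)  ∎)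
  where open ≡-Reasoning

paths-sucˡ : ∀ u v → paths (suc u) v * suc u ≡ paths u v * suc (u + v)
paths-sucˡ u v = *-cancelʳ-≡ _ _ (u ! * v !) {{u !* v !≢0}} (begin
  paths (suc u) v * suc u * (u ! * v !)   ≡⟨ solve 4 (λ p s a b → p :* s :* (a :* b) := p :* (s :* a :* b)) refl (paths (suc u) v) (suc u) (u !) (v !) ⟩
  paths (suc u) v * (suc u ! * v !)       ≡⟨ paths-! (suc u) v ⟩
  suc (u + v) * (u + v) !                 ≡⟨ cong (suc (u + v) *_) (paths-! u v) ⟨
  suc (u + v) * (paths u v * (u ! * v !)) ≡⟨ solve 3 (λ s p d → s :* (p :* d) := p :* s :* d) refl (suc (u + v)) (paths u v) (u ! * v !) ⟩
  paths u v * suc (u + v) * (u ! * v !)   ∎)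
  where open ≡-Reasoning

paths-sucʳ : ∀ u v → paths u (suc v) * suc v ≡ paths u v * suc (u + v)
paths-sucʳ u v = begin
  paths u (suc v) * suc v  ≡⟨ cong (_* suc v) (paths-comm u (suc v)) ⟩
  paths (suc v) u * suc v  ≡⟨ paths-sucˡ v u ⟩
  paths v u * suc (v + u)  ≡⟨ cong₂ (λ p s → p * suc s) (paths-comm v u) (+-comm v u) ⟩
  paths u v * suc (u + v)  ∎
  where open ≡-Reasoning

gap-ratio-step-x : ∀ K x y e → paths (suc x) (K + y) ≤ e * paths (K + suc x) y →
                   paths x (K + y) ≤ e * paths (K + x) y
gap-ratio-step-x K x y e step = *-cancelʳ-≤ _ _ (suc (x + (K + y))) (begin
  paths x (K + y) * suc (x + (K + y))      ≡⟨ paths-sucˡ x (K + y) ⟨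
  paths (suc x) (K + y) * suc x            ≤⟨ *-monoˡ-≤ (suc x) step ⟩
  e * P (K + suc x) * suc x                ≡⟨ cong (λ u → e * P u * suc x) (+-suc K x) ⟩
  e * P (suc (K + x)) * suc x              ≤⟨ *-monoʳ-≤ (e * P (suc (K + x))) (s≤s (m≤n+m x K)) ⟩
  e * P (suc (K + x)) * suc (K + x)        ≡⟨ *-assoc e _ _ ⟩
  e * (P (suc (K + x)) * suc (K + x))      ≡⟨ cong (e *_) (paths-sucˡ (K + x) y) ⟩
  e * (P (K + x) * suc (K + x + y))        ≡⟨ *-assoc e _ _ ⟨
  e * P (K + x) * suc (K + x + y)          ≡⟨ cong (λ s → e * P (K + x) * suc s) (solve 3 (λ K x y → K :+ x :+ y := x :+ (K :+ y)) refl K x y) ⟩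
  e * P (K + x) * suc (x + (K + y))        ∎)
  where
  open ≤-Reasoning
  P : ℕ → ℕ
  P u = paths u y

gap-ratio-step-y : ∀ K x y e → K ≤ 2 * suc y → paths x (K + suc y) ≤ e * paths (K + x) (suc y) →
                   paths x (K + y) ≤ 3 * e * paths (K + x) y
gap-ratio-step-y K x y e K≤2[1+y] step = *-cancelʳ-≤ _ _ (suc (x + (K + y))) (begin
  paths x (K + y) * suc (x + (K + y))      ≡⟨ paths-sucʳ x (K + y) ⟨
  paths x (suc (K + y)) * suc (K + y)      ≡⟨ cong (λ v → paths x v * suc (K + y)) (+-suc K y) ⟨
  paths x (K + suc y) * suc (K + y)        ≤⟨ *-monoˡ-≤ (suc (K + y)) step ⟩
  e * P (suc y) * suc (K + y)              ≡⟨ cong (λ v → e * P (suc y) * v) (+-suc K y) ⟨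
  e * P (suc y) * (K + suc y)              ≤⟨ *-monoʳ-≤ (e * P (suc y)) (+-monoˡ-≤ (suc y) K≤2[1+y]) ⟩
  e * P (suc y) * (2 * suc y + suc y)      ≡⟨ solve 3 (λ e p s → e :* p :* (con 2 :* s :+ s) := con 3 :* e :* (p :* s)) refl e (P (suc y)) (suc y) ⟩
  3 * e * (P (suc y) * suc y)              ≡⟨ cong (3 * e *_) (paths-sucʳ (K + x) y) ⟩
  3 * e * (P y * suc (K + x + y))          ≡⟨ *-assoc (3 * e) _ _ ⟨
  3 * e * P y * suc (K + x + y)            ≡⟨ cong (λ s → 3 * e * P y * suc s) (solve 3 (λ K x y → K :+ x :+ y := x :+ (K :+ y)) refl K x y) ⟩
  3 * e * P y * suc (x + (K + y))          ∎)
  where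
  open ≤-Reasoning
  P : ℕ → ℕ
  P v = paths (K + x) v

gap-ratio : ∀ K a b x y → x + a ≡ K → y + b ≡ K → 2 * b ≤ K →
            paths x (K + y) ≤ 3 ^ b * paths (K + x) y
gap-ratio K (suc a) b x y x+a≡K y+b≡K 2b≤K =
  gap-ratio-step-x K x y (3 ^ b) (gap-ratio K a b (suc x) y (trans (sym (+-suc x a)) x+a≡K) y+b≡K 2b≤K)
gap-ratio K zero (suc b) x y x+a≡K y+b≡K 2b≤K =
  gap-ratio-step-y K x y (3 ^ b) K≤2[1+y]
    (gap-ratio K zero b x (suc y) x+a≡K (trans (sym (+-suc y b)) y+b≡K) (≤-trans (*-monoʳ-≤ 2 (n≤1+n b)) 2b≤K))
  where
  1+b≤y : suc b ≤ y
  1+b≤y = +-cancelʳ-≤ (suc b) (suc b) y (subst₂ _≤_ (cong (suc b +_) (+-identityʳ (suc b))) (sym y+b≡K) 2b≤K)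
  K≤2[1+y] : K ≤ 2 * suc y
  K≤2[1+y] = begin
    K              ≡⟨ y+b≡K ⟨
    y + suc b      ≤⟨ +-monoʳ-≤ y (≤-trans 1+b≤y (n≤1+n y)) ⟩
    y + suc y      ≤⟨ +-monoˡ-≤ (suc y) (n≤1+n y) ⟩
    suc y + suc y  ≡⟨ cong (suc y +_) (+-identityʳ (suc y)) ⟨
    2 * suc y      ∎
    where open ≤-Reasoning
gap-ratio K zero zero x y x+a≡K y+b≡K _ = begin
  paths x (K + y)      ≡⟨ cong₂ (λ u v → paths u (K + v)) x≡K y≡K ⟩
  paths K (K + K)      ≡⟨ paths-comm K (K + K) ⟩
  paths (K + K) K      ≡⟨ cong₂ (λ u v → paths (K + u) v) x≡K y≡K ⟨
  paths (K + x) y      ≡⟨ *-identityˡ _ ⟨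
  1 * paths (K + x) y  ∎
  where
  open ≤-Reasoning
  x≡K : x ≡ K
  x≡K = trans (sym (+-identityʳ x)) x+a≡K
  y≡K : y ≡ K
  y≡K = trans (sym (+-identityʳ y)) y+b≡K

filter-map : ∀ {a b p} {A : Set a} {B : Set b} {P : Pred B p} (P? : Decidable P) (f : A → B) xs →
             filter P? (map f xs) ≡ map f (filter (P? ∘ f) xs)
filter-map P? f [] = refl
filter-map P? f (x ∷ xs) with does (P? (f x))
... | true = cong (f x ∷_) (filter-map P? f xs)
... | false = filter-map P? f xs

length-filter-filter-map : ∀ {a b p q} {A : Set a} {B : Set b} {P : Pred B p} {Q : Pred B q}
  (P? : Decidable P) (Q? : Decidable Q) (f : A → B) xs →
  length (filter P? (filter Q? (map f xs))) ≡ length (filter (P? ∘ f) (filter (Q? ∘ f) xs))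
length-filter-filter-map P? Q? f xs = begin
  length (filter P? (filter Q? (map f xs)))          ≡⟨ cong (length ∘ filter P?) (filter-map Q? f xs) ⟩
  length (filter P? (map f (filter (Q? ∘ f) xs)))    ≡⟨ cong length (filter-map P? f (filter (Q? ∘ f) xs)) ⟩
  length (map f (filter (P? ∘ f) (filter (Q? ∘ f) xs))) ≡⟨ length-map f (filter (P? ∘ f) (filter (Q? ∘ f) xs)) ⟩
  length (filter (P? ∘ f) (filter (Q? ∘ f) xs))     ∎
  where open ≡-Reasoning

allowsFirst : ∀ {m} → Conjunction (suc m) → Bool → Bool
allowsFirst [] b = true
allowsFirst ((zero , true) ∷ C) b = b ∧ allowsFirst C b
allowsFirst ((zero , false) ∷ C) b = not b ∧ allowsFirst C b
allowsFirst ((suc i , p) ∷ C) b = allowsFirst C b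

dropFirst : ∀ {m} → Conjunction (suc m) → Conjunction m
dropFirst [] = []
dropFirst ((zero , p) ∷ C) = dropFirst C
dropFirst ((suc i , p) ∷ C) = (i , p) ∷ dropFirst C

evalC-∷ : ∀ {m} (C : Conjunction (suc m)) b x → evalC C (b ∷ x) ≡ allowsFirst C b ∧ evalC (dropFirst C) x
evalC-∷ [] b x = refl
evalC-∷ ((zero , true) ∷ C) b x = trans (cong (b ∧_) (evalC-∷ C b x)) (sym (∧-assoc b _ _))
evalC-∷ ((zero , false) ∷ C) b x = trans (cong (not b ∧_) (evalC-∷ C b x)) (sym (∧-assoc (not b) _ _))
evalC-∷ ((suc i , p) ∷ C) b x =
  trans (cong₂ _∧_ (evalLit-suc p) (evalC-∷ C b x)) (x∙yz≈y∙xz (evalLit (i , p) x) (allowsFirst C b) (evalC (dropFirst C) x))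
  where
  evalLit-suc : ∀ p → evalLit (suc i , p) (b ∷ x) ≡ evalLit (i , p) x
  evalLit-suc true = refl
  evalLit-suc false = refl

width-dropFirst-≤ : ∀ {m} (C : Conjunction (suc m)) → width (dropFirst C) ≤ width C
width-dropFirst-≤ [] = z≤n
width-dropFirst-≤ ((zero , p) ∷ C) = ≤-trans (width-dropFirst-≤ C) (n≤1+n _)
width-dropFirst-≤ ((suc i , p) ∷ C) = s≤s (width-dropFirst-≤ C)

width-dropFirst-< : ∀ {m} (C : Conjunction (suc m)) b → allowsFirst C b ≡ false → width (dropFirst C) < width C
width-dropFirst-< [] b ()
width-dropFirst-< ((zero , p) ∷ C) b _ = s≤s (width-dropFirst-≤ C)
width-dropFirst-< ((suc i , p) ∷ C) b h = s≤s (width-dropFirst-< C b h)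

ofWeight : ∀ {m} → ℕ → List (Vec Bool m) → List (Vec Bool m)
ofWeight t = filter (λ x → weight x ≟ℕ t)

satisfying : ∀ {m} → Conjunction m → List (Vec Bool m) → List (Vec Bool m)
satisfying C = filter (λ x → evalC C x ≟ true)

satCountIn : ∀ {m} → Conjunction m → ℕ → List (Vec Bool m) → ℕ
satCountIn C t xs = length (satisfying C (ofWeight t xs))

-- hits k C z unfolds to satCount C (gapWeight k z).
satCount : ∀ {m} → Conjunction m → ℕ → ℕ
satCount {m} C t = satCountIn C t (cube m)

satCountIn-++ : ∀ {m} (C : Conjunction m) t xs ys → satCountIn C t (xs ++ ys) ≡ satCountIn C t xs + satCountIn C t ys
satCountIn-++ C t xs ys = begin
  length (satisfying C (ofWeight t (xs ++ ys)))                           ≡⟨ cong (length ∘ satisfying C) (filter-++ _ xs ys) ⟩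
  length (satisfying C (ofWeight t xs ++ ofWeight t ys))                  ≡⟨ cong length (filter-++ _ (ofWeight t xs) (ofWeight t ys)) ⟩
  length (satisfying C (ofWeight t xs) ++ satisfying C (ofWeight t ys))   ≡⟨ length-++ (satisfying C (ofWeight t xs)) ⟩
  satCountIn C t xs + satCountIn C t ys                                   ∎
  where open ≡-Reasoning

length-satisfying-∧ : ∀ {m} h (C : Conjunction m) xs →
  length (filter (λ x → h ∧ evalC C x ≟ true) xs) ≡ (if h then length (satisfying C xs) else 0)
length-satisfying-∧ true C xs = refl
length-satisfying-∧ false C xs = cong length (filter-none (λ x → false ≟ true) (All.universal (λ _ ()) xs))

satCountIn-map-∷ : ∀ {m} (C : Conjunction (suc m)) b t xs →
  satCountIn C t (map (b ∷_) xs)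
    ≡ (if allowsFirst C b then length (satisfying (dropFirst C) (filter (λ x → weight (b ∷ x) ≟ℕ t) xs)) else 0)
satCountIn-map-∷ {m} C b t xs = trans (length-filter-filter-map _ _ (b ∷_) xs) (trans
  (cong length (filter-≐ _ _ ((λ {x} → trans (sym (evalC-∷ C b x))) , (λ {x} → trans (evalC-∷ C b x))) ys))
  (length-satisfying-∧ (allowsFirst C b) (dropFirst C) ys))
  where
  ys : List (Vec Bool m)
  ys = filter (λ x → weight (b ∷ x) ≟ℕ t) xs

satisfying-weight-suc : ∀ {m} (C : Conjunction m) xs t →
  length (satisfying C (filter (λ x → suc (weight x) ≟ℕ t) xs)) ≡ shift (λ s → satCountIn C s xs) t
satisfying-weight-suc C xs zero = cong (length ∘ satisfying C) (filter-none (λ x → suc (weight x) ≟ℕ zero) (All.universal (λ _ ()) xs))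
satisfying-weight-suc C xs (suc t) = cong (length ∘ satisfying C) (filter-≐ _ _ (suc-injective , cong suc) xs)

satCount-∷ : ∀ {m} (C : Conjunction (suc m)) t →
  satCount C t ≡ (if allowsFirst C false then satCount (dropFirst C) t else 0)
               + (if allowsFirst C true then shift (satCount (dropFirst C)) t else 0)
satCount-∷ {m} C t = trans (satCountIn-++ C t (map (false ∷_) (cube m)) (map (true ∷_) (cube m)))
  (cong₂ _+_ (satCountIn-map-∷ C false t (cube m))
             (trans (satCountIn-map-∷ C true t (cube m))
                    (cong (if allowsFirst C true then_else 0) (satisfying-weight-suc (dropFirst C) (cube m) t))))

satCount-[] : ∀ m t → satCount {m} [] t ≡ (m choose t)
satCount-[] zero zero = refl
satCount-[] zero (suc t) = refl
satCount-[] (suc m) t = begin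
  satCount {suc m} [] t                              ≡⟨ satCount-∷ {m} [] t ⟩
  satCount {m} [] t + shift (satCount {m} []) t      ≡⟨ cong₂ _+_ (satCount-[] m t) (shift-cong (satCount-[] m) t) ⟩
  (m choose t) + shift (m choose_) t                 ≡⟨ choose-pascal m t ⟩
  (suc m choose t)                                   ∎
  where open ≡-Reasoning

record BinomialProfile (m w : ℕ) (N : ℕ → ℕ) : Set where
  field
    pos neg free : ℕ
    size : pos + neg + free ≡ m
    bounded : pos + neg ≤ w
    shape : ∀ t → N t ≡ shiftBy pos (free choose_) t

WeightProfile : ℕ → ℕ → (ℕ → ℕ) → Set
WeightProfile m w N = (∀ t → N t ≡ 0) ⊎ BinomialProfile m w N

profile-step : ∀ {m w w'} {M N : ℕ → ℕ} h₀ h₁ →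
  (∀ t → N t ≡ (if h₀ then M t else 0) + (if h₁ then shift M t else 0)) →
  w' ≤ w → (h₀ ≡ false ⊎ h₁ ≡ false → w' < w) →
  WeightProfile m w' M → WeightProfile (suc m) w N
profile-step false false N≡ _ _ _ = inj₁ N≡
profile-step true true N≡ _ _ (inj₁ M≡0) =
  inj₁ λ t → trans (N≡ t) (cong₂ _+_ (M≡0 t) (shift-zero M≡0 t))
profile-step true false N≡ _ _ (inj₁ M≡0) = inj₁ λ t → trans (N≡ t) (trans (+-identityʳ _) (M≡0 t))
profile-step false true N≡ _ _ (inj₁ M≡0) = inj₁ λ t → trans (N≡ t) (shift-zero M≡0 t)
profile-step true true N≡ w'≤w _ (inj₂ P) = inj₂ record
  { pos = pos ; neg = neg ; free = suc free
  ; size = trans (+-suc (pos + neg) free) (cong suc size)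
  ; bounded = ≤-trans bounded w'≤w
  ; shape = λ t → trans (N≡ t) (trans (cong₂ _+_ (shape t) (shift-cong shape t)) (shiftBy-pascal pos free t))
  }
  where open BinomialProfile P
profile-step true false N≡ _ w'<w (inj₂ P) = inj₂ record
  { pos = pos ; neg = suc neg ; free = free
  ; size = trans (cong (_+ free) (+-suc pos neg)) (cong suc size)
  ; bounded = ≤-trans (≤-reflexive (+-suc pos neg)) (≤-trans (s≤s bounded) (w'<w (inj₂ refl)))
  ; shape = λ t → trans (N≡ t) (trans (+-identityʳ _) (shape t))
  }
  where open BinomialProfile P
profile-step false true N≡ _ w'<w (inj₂ P) = inj₂ record
  { pos = suc pos ; neg = neg ; free = free
  ; size = cong suc size
  ; bounded = ≤-trans (s≤s bounded) (w'<w (inj₁ refl))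
  ; shape = λ t → trans (N≡ t) (shift-cong shape t)
  }
  where open BinomialProfile P

satCount-profile : ∀ {m} (C : Conjunction m) → WeightProfile m (width C) (satCount C)
satCount-profile {zero} [] = inj₂ record
  { pos = 0 ; neg = 0 ; free = 0 ; size = refl ; bounded = z≤n ; shape = satCount-[] 0 }
satCount-profile {zero} ((() , _) ∷ _)
satCount-profile {suc m} C =
  profile-step (allowsFirst C false) (allowsFirst C true) (satCount-∷ C)
    (width-dropFirst-≤ C) fixes-first (satCount-profile (dropFirst C))
  where
  fixes-first : allowsFirst C false ≡ false ⊎ allowsFirst C true ≡ false → width (dropFirst C) < width C
  fixes-first (inj₁ e) = width-dropFirst-< C false e
  fixes-first (inj₂ e) = width-dropFirst-< C true e

profile-value : ∀ {m w N} (P : BinomialProfile m w N) u v → u + v ≡ BinomialProfile.free P →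
                N (BinomialProfile.pos P + u) ≡ paths u v
profile-value P u v u+v≡free = trans (shape (pos + u)) (trans (shiftBy-+ pos _ u) (cong (_choose u) (sym u+v≡free)))
  where open BinomialProfile P

7a≤3K⇒2a≤K : ∀ a K → 7 * a ≤ 3 * K → 2 * a ≤ K
7a≤3K⇒2a≤K a K 7a≤3K = *-cancelˡ-≤ 3 (begin
  3 * (2 * a)  ≡⟨ solve 1 (λ a → con 3 :* (con 2 :* a) := con 6 :* a) refl a ⟩
  6 * a        ≤⟨ *-monoˡ-≤ a (n≤1+n 6) ⟩
  7 * a        ≤⟨ 7a≤3K ⟩
  3 * K        ∎)
  where open ≤-Reasoning

gap-weight-values : ∀ {K w N} (P : BinomialProfile (3 * K) w N) x y →
  x + BinomialProfile.pos P ≡ K → y + BinomialProfile.neg P ≡ K →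
  N K ≡ paths x (K + y) × N (K + K) ≡ paths (K + x) y
gap-weight-values {K} {N = N} P x y x+pos≡K y+neg≡K =
  trans (cong N (trans (sym x+pos≡K) (+-comm x pos))) (profile-value P x (K + y) (sym free≡)) ,
  trans (cong N 2K≡pos+[K+x]) (profile-value P (K + x) y (trans (solve 3 (λ K x y → K :+ x :+ y := x :+ (K :+ y)) refl K x y) (sym free≡)))
  where
  open BinomialProfile P
  open ≡-Reasoning
  free≡ : free ≡ x + (K + y)
  free≡ = +-cancelˡ-≡ (pos + neg) free (x + (K + y)) (begin
    pos + neg + free              ≡⟨ size ⟩
    3 * K                         ≡⟨ solve 1 (λ K → con 3 :* K := K :+ K :+ K) refl K ⟩
    K + K + K                     ≡⟨ cong₂ (λ a b → a + K + b) x+pos≡K y+neg≡K ⟨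
    x + pos + K + (y + neg)       ≡⟨ solve 5 (λ x p K y n → x :+ p :+ K :+ (y :+ n) := p :+ n :+ (x :+ (K :+ y))) refl x pos K y neg ⟩
    pos + neg + (x + (K + y))     ∎)
  2K≡pos+[K+x] : K + K ≡ pos + (K + x)
  2K≡pos+[K+x] = trans (cong (K +_) (sym x+pos≡K)) (solve 3 (λ K x p → K :+ (x :+ p) := p :+ (K :+ x)) refl K x pos)

gap-bound : ∀ K {w N} → BinomialProfile (3 * K) w N → 7 * w ≤ 3 * K → ∀ z →
            N (gapWeight K z) ≤ 3 ^ w * N (gapWeight K (not z))
gap-bound K {w} {N} P 7w≤3K = bound
  where
  open BinomialProfile P
  open ≤-Reasoning

  2pos≤K : 2 * pos ≤ K
  2pos≤K = 7a≤3K⇒2a≤K pos K (≤-trans (*-monoʳ-≤ 7 (≤-trans (m≤m+n pos neg) bounded)) 7w≤3K)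
  2neg≤K : 2 * neg ≤ K
  2neg≤K = 7a≤3K⇒2a≤K neg K (≤-trans (*-monoʳ-≤ 7 (≤-trans (m≤n+m neg pos) bounded)) 7w≤3K)

  x y : ℕ
  x = K ∸ pos
  y = K ∸ neg
  x+pos≡K : x + pos ≡ K
  x+pos≡K = m∸n+n≡m (≤-trans (m≤n*m pos 2) 2pos≤K)
  y+neg≡K : y + neg ≡ K
  y+neg≡K = m∸n+n≡m (≤-trans (m≤n*m neg 2) 2neg≤K)

  N[K] : N K ≡ paths x (K + y)
  N[K] = proj₁ (gap-weight-values P x y x+pos≡K y+neg≡K)
  N[2K] : N (K + K) ≡ paths (K + x) y
  N[2K] = proj₂ (gap-weight-values P x y x+pos≡K y+neg≡K)

  bound : ∀ z → N (gapWeight K z) ≤ 3 ^ w * N (gapWeight K (not z))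
  bound false = begin
    N K                        ≡⟨ N[K] ⟩
    paths x (K + y)            ≤⟨ gap-ratio K pos neg x y x+pos≡K y+neg≡K 2neg≤K ⟩
    3 ^ neg * paths (K + x) y  ≤⟨ *-monoˡ-≤ _ (^-monoʳ-≤ 3 (≤-trans (m≤n+m neg pos) bounded)) ⟩
    3 ^ w * paths (K + x) y    ≡⟨ cong (3 ^ w *_) N[2K] ⟨
    3 ^ w * N (K + K)          ∎
  bound true = begin
    N (K + K)                  ≡⟨ N[2K] ⟩
    paths (K + x) y            ≡⟨ paths-comm (K + x) y ⟩
    paths y (K + x)            ≤⟨ gap-ratio K neg pos y x y+neg≡K x+pos≡K 2pos≤K ⟩
    3 ^ pos * paths (K + y) x  ≤⟨ *-monoˡ-≤ _ (^-monoʳ-≤ 3 (≤-trans (m≤m+n pos neg) bounded)) ⟩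
    3 ^ w * paths (K + y) x    ≡⟨ cong (3 ^ w *_) (trans (paths-comm (K + y) x) (sym N[K])) ⟩
    3 ^ w * N K                ∎

total-choose : ∀ k z → total k z ≡ ((3 * k) choose gapWeight k z)
total-choose k z = trans (cong length (sym (filter-all (λ x → evalC [] x ≟ true) (All.universal (λ _ → refl) xs))))
                         (satCount-[] (3 * k) (gapWeight k z))
  where
  xs : List (Vec Bool (3 * k))
  xs = filter (λ x → weight x ≟ℕ gapWeight k z) (cube (3 * k))

total-not : ∀ k z → total k (not z) ≡ total k z
total-not k false = trans (total-choose k true) (trans choose-2k≡choose-k (sym (total-choose k false)))
  where
  open ≡-Reasoning
  choose-2k≡choose-k : ((3 * k) choose (k + k)) ≡ ((3 * k) choose k)
  choose-2k≡choose-k = begin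
    (3 * k) choose (k + k)  ≡⟨ cong (_choose (k + k)) (solve 1 (λ k → con 3 :* k := k :+ k :+ k) refl k) ⟩
    paths (k + k) k         ≡⟨ paths-comm (k + k) k ⟩
    paths k (k + k)         ≡⟨ cong (_choose k) (solve 1 (λ k → con 3 :* k := k :+ (k :+ k)) refl k) ⟨
    (3 * k) choose k        ∎
total-not k true = sym (total-not k false)

fact6 : (k : ℕ) (C : Conjunction (3 * suc k)) → 7 * width C ≤ 3 * suc k → (z : Bool) →
          hits (suc k) C z * total (suc k) (not z) ≤ 3 ^ width C * hits (suc k) C (not z) * total (suc k) z
fact6 k C 7w≤m z with satCount-profile C
... | inj₁ unsatisfiable = ≤-trans (≤-reflexive (cong (_* total (suc k) (not z)) (unsatisfiable _))) z≤n
... | inj₂ P = begin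
  hits K C z * total K (not z)              ≡⟨ cong (hits K C z *_) (total-not K z) ⟩
  hits K C z * total K z                    ≤⟨ *-monoˡ-≤ (total K z) (gap-bound K P 7w≤m z) ⟩
  3 ^ width C * hits K C (not z) * total K z ∎
  where
  open ≤-Reasoning
  K : ℕ
  K = suc k
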